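{- Let $p$ be an odd prime which is a rogue prime, let $i\in\{1,2\}$ and $g\in A_i^p$. Then $\langle g\rangle_i^p$ is a rogue loop if and only if $g$ is not a term of the rogue sequence $\langle(-1)^{i+1}\rangle_i^p$.
   Context: For an odd prime $p$ and $i\in\{1,2\}$, let $A_i^p=(\mathbb{Z}/p\mathbb{Z})^\times\setminus\{(-1)^i \bmod p\}$. For $g\in A_i^p$ define $u_1=g$ and $u_n=2u_{n-1}+(-1)^{i+1}$ in $\mathbb{Z}/p\mathbb{Z}$ for $n>1$; let $g_k^i=\min(\{n\in\mathbb{N}: u_n=0\}\cup\{\infty\})$, and call $\langle g\rangle_i^p=(u_n)_{1\le n<g_k^i}$ the rogue sequence of $g$. A rogue loop is a periodic rogue sequence (one never reaching $0$). $p$ is a rogue prime if for some $j\in\{1,2\}$ there is $g\in A_j^p$ with $\langle g\rangle_j^p$ a rogue loop; equivalently, $2$ is not a primitive root modulo $p$. -}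

module Defs where

open import Data.Nat using (ℕ; zero; suc; _+_; _*_; _∸_; _≤_; _<_; NonZero)
open import Data.Nat.DivMod using (_%_)
open import Data.Product using (Σ; _×_; ∃)
open import Data.Sum using (_⊎_)
open import Relation.Binary.PropositionalEquality using (_≡_; _≢_)
open import Relation.Nullary using (¬_)

negOnePow : (p : ℕ) → .{{NonZero p}} → ℕ → ℕ
negOnePow p zero    = 1 % p
negOnePow p (suc i) = (p ∸ negOnePow p i) % p

InA : (p : ℕ) → .{{NonZero p}} → ℕ → ℕ → Set
InA p i g = (1 ≤ g) × (g < p) × (g ≢ negOnePow p i)

step : (p : ℕ) → .{{NonZero p}} → ℕ → ℕ → ℕ
step p i u = (2 * u + negOnePow p (suc i)) % p

-- 0-indexed: seqU p i g n is the paper's u_{n+1}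
seqU : (p : ℕ) → .{{NonZero p}} → ℕ → ℕ → ℕ → ℕ
seqU p i g zero    = g
seqU p i g (suc n) = step p i (seqU p i g n)

-- x is a term of the rogue sequence ⟨h⟩_i^p, i.e. x = u_n for some n with 1 ≤ n < g_k^i
-- (equivalently no earlier-or-equal term is 0)
IsTerm : (p : ℕ) → .{{NonZero p}} → ℕ → ℕ → ℕ → Set
IsTerm p i h x = ∃ λ n → (seqU p i h n ≡ x) × (∀ m → m ≤ n → seqU p i h m ≢ 0)

RogueLoop : (p : ℕ) → .{{NonZero p}} → ℕ → ℕ → Set
RogueLoop p i g =
  (∀ n → seqU p i g n ≢ 0) ×
  (∃ λ T → (1 ≤ T) × (∀ n → seqU p i g (n + T) ≡ seqU p i g n))

RoguePrime : (p : ℕ) → .{{NonZero p}} → Set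
RoguePrime p = ∃ λ j → ((j ≡ 1) ⊎ (j ≡ 2)) × (∃ λ g → InA p j g × RogueLoop p j g)

-- For an odd prime p the step u ↦ 2u + c is injective on residues, hence a permutation,
-- so every orbit is a cycle and y lies on the orbit of x exactly when x lies on the orbit
-- of y. The step sends 0 to c = (-1)^(i+1), so ⟨c⟩ is the orbit of 0 with its first term
-- removed. Hence g ≠ 0 reaches 0 iff g lies on the orbit of 0 iff g occurs in ⟨c⟩ before
-- that sequence itself returns to 0.
module Submission where

open import Defs
open import Data.Nat using (ℕ; zero; suc; _+_; _*_; _∸_; _≤_; _<_; z≤n; s≤s; z<s; NonZero; nonTrivial⇒n>1; _≟_)
open import Data.Nat.Properties
open import Data.Nat.DivMod using (_%_; _/_; m≡m%n+[m/n]*n; m%n<n; m%n%n≡m%n)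
open import Data.Nat.Divisibility using (_∣_; _∤_; divides; ∣⇒≤; >⇒∤)
open import Data.Nat.Primality using (Prime; euclidsLemma; prime⇒nonTrivial)
open import Data.Nat.Induction using (<-rec)
open import Data.Fin using (toℕ; fromℕ<)
open import Data.Fin.Properties using (pigeonhole; toℕ-fromℕ<)
open import Data.Product using (∃; _,_)
open import Data.Sum using (_⊎_; inj₁; inj₂)
open import Relation.Nullary using (¬_; yes; no; contradiction)
open import Relation.Binary.PropositionalEquality using (_≡_; _≢_; refl; sym; trans; cong; cong₂; subst; module ≡-Reasoning)
open import Function.Bundles using (_⇔_; mk⇔)

open ≡-Reasoning

%≡%⇒∣∸ : ∀ n .{{_ : NonZero n}} {a b} → a ≤ b → a % n ≡ b % n → n ∣ b ∸ a
%≡%⇒∣∸ n {a} {b} a≤b a%n≡b%n = divides (b / n ∸ a / n) (begin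
  b ∸ a                                       ≡⟨ cong₂ _∸_ (m≡m%n+[m/n]*n b n) (m≡m%n+[m/n]*n a n) ⟩
  (b % n + b / n * n) ∸ (a % n + a / n * n)   ≡⟨ cong (λ r → (b % n + b / n * n) ∸ (r + a / n * n)) a%n≡b%n ⟩
  (b % n + b / n * n) ∸ (b % n + a / n * n)   ≡⟨ [m+n]∸[m+o]≡n∸o (b % n) _ _ ⟩
  b / n * n ∸ a / n * n                       ≡⟨ sym (*-distribʳ-∸ n (b / n) (a / n)) ⟩
  (b / n ∸ a / n) * n                         ∎)

∣∸∧<⇒≡ : ∀ {d m n} → m ≤ n → n < d → d ∣ n ∸ m → m ≡ n
∣∸∧<⇒≡ {m = m} {n} m≤n n<d d∣n∸m with n ∸ m in n∸m≡
... | zero  = ≤-antisym m≤n (m∸n≡0⇒m≤n n∸m≡)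
... | suc k = contradiction d∣n∸m (>⇒∤ (≤-<-trans (subst (_≤ n) n∸m≡ (m∸n≤m n m)) n<d))

prime≢2⇒∤2 : ∀ {p} → Prime p → p ≢ 2 → p ∤ 2
prime≢2⇒∤2 {p} pr p≢2 p∣2 =
  p≢2 (≤-antisym (∣⇒≤ p∣2) (nonTrivial⇒n>1 p {{prime⇒nonTrivial pr}}))

affine-%-≤-injective : ∀ {p} .{{_ : NonZero p}} → Prime p → ∀ {a} → p ∤ a → ∀ c {x y} →
  x ≤ y → y < p → (a * x + c) % p ≡ (a * y + c) % p → x ≡ y
affine-%-≤-injective {p} pr {a} p∤a c {x} {y} x≤y y<p eq
  with euclidsLemma a (y ∸ x) pr (subst (p ∣_) difference (%≡%⇒∣∸ p (+-monoˡ-≤ c (*-monoʳ-≤ a x≤y)) eq))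
  where
  difference : (a * y + c) ∸ (a * x + c) ≡ a * (y ∸ x)
  difference = begin
    (a * y + c) ∸ (a * x + c)   ≡⟨ cong₂ _∸_ (+-comm (a * y) c) (+-comm (a * x) c) ⟩
    (c + a * y) ∸ (c + a * x)   ≡⟨ [m+n]∸[m+o]≡n∸o c (a * y) (a * x) ⟩
    a * y ∸ a * x               ≡⟨ sym (*-distribˡ-∸ a y x) ⟩
    a * (y ∸ x)                 ∎
... | inj₁ p∣a   = contradiction p∣a p∤a
... | inj₂ p∣y∸x = ∣∸∧<⇒≡ x≤y y<p p∣y∸x

affine-%-injective : ∀ {p} .{{_ : NonZero p}} → Prime p → ∀ {a} → p ∤ a → ∀ c {x y} →
  x < p → y < p → (a * x + c) % p ≡ (a * y + c) % p → x ≡ y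
affine-%-injective pr p∤a c {x} {y} x<p y<p eq with ≤-total x y
... | inj₁ x≤y = affine-%-≤-injective pr p∤a c x≤y y<p eq
... | inj₂ y≤x = sym (affine-%-≤-injective pr p∤a c y≤x x<p (sym eq))

prime≢2⇒step-injective : ∀ {p} .{{_ : NonZero p}} → Prime p → p ≢ 2 → ∀ i {x y} →
  x < p → y < p → step p i x ≡ step p i y → x ≡ y
prime≢2⇒step-injective pr p≢2 i = affine-%-injective pr (prime≢2⇒∤2 pr p≢2) _

module _ (p : ℕ) .{{_ : NonZero p}} (i : ℕ) where

  seqU-suc : ∀ x n → seqU p i x (suc n) ≡ seqU p i (step p i x) n
  seqU-suc x zero    = refl
  seqU-suc x (suc n) = cong (step p i) (seqU-suc x n)

  seqU-+ : ∀ x m n → seqU p i x (m + n) ≡ seqU p i (seqU p i x n) m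
  seqU-+ x zero    n = refl
  seqU-+ x (suc m) n = cong (step p i) (seqU-+ x m n)

  seqU-< : ∀ {x} → x < p → ∀ n → seqU p i x n < p
  seqU-< x<p zero    = x<p
  seqU-< x<p (suc n) = m%n<n _ p

  seqU-+-period : ∀ {x T} → seqU p i x T ≡ x → ∀ n → seqU p i x (n + T) ≡ seqU p i x n
  seqU-+-period {x} {T} xT≡x n = trans (seqU-+ x n T) (cong (λ y → seqU p i y n) xT≡x)

  seqU-*-period : ∀ {x T} → seqU p i x T ≡ x → ∀ k → seqU p i x (k * T) ≡ x
  seqU-*-period {x} {T} xT≡x zero    = refl
  seqU-*-period {x} {T} xT≡x (suc k) = begin
    seqU p i x (T + k * T)           ≡⟨ seqU-+ x T (k * T) ⟩
    seqU p i (seqU p i x (k * T)) T  ≡⟨ cong (λ y → seqU p i y T) (seqU-*-period xT≡x k) ⟩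
    seqU p i x T                     ≡⟨ xT≡x ⟩
    x                                ∎

  private
    c : ℕ
    c = negOnePow p (suc i)

  step-zero : step p i 0 ≡ c
  step-zero = m%n%n≡m%n (p ∸ negOnePow p i) p

  seqU-zero-suc : ∀ n → seqU p i 0 (suc n) ≡ seqU p i c n
  seqU-zero-suc n = trans (seqU-suc 0 n) (cong (λ x → seqU p i x n) step-zero)

  seqU-restart : ∀ {j} → seqU p i c j ≡ 0 → ∀ k → seqU p i c (k + suc j) ≡ seqU p i c k
  seqU-restart {j} cj≡0 k = begin
    seqU p i c (k + suc j)                ≡⟨ seqU-+ c k (suc j) ⟩
    seqU p i (step p i (seqU p i c j)) k  ≡⟨ cong (λ x → seqU p i (step p i x) k) cj≡0 ⟩
    seqU p i (step p i 0) k               ≡⟨ cong (λ x → seqU p i x k) step-zero ⟩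
    seqU p i c k                          ∎

  occurs⇒IsTerm : ∀ {g} → g ≢ 0 → ∀ m → seqU p i c m ≡ g → IsTerm p i c g
  occurs⇒IsTerm {g} g≢0 = <-rec (λ m → seqU p i c m ≡ g → IsTerm p i c g) earliest
    where
    earliest : ∀ m → (∀ {k} → k < m → seqU p i c k ≡ g → IsTerm p i c g) →
               seqU p i c m ≡ g → IsTerm p i c g
    earliest m rec cm≡g with anyUpTo? (λ j → seqU p i c j ≟ 0) (suc m)
    ... | no ¬zero = m , cm≡g , λ j j≤m cj≡0 → ¬zero (j , s≤s j≤m , cj≡0)
    ... | yes (j , s≤s j≤m , cj≡0) with m≤n⇒m<n∨m≡n j≤m
    ...   | inj₂ refl = contradiction (trans (sym cm≡g) cj≡0) g≢0
    ...   | inj₁ j<m  = rec (∸-monoʳ-< z<s j<m) (begin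
      seqU p i c (m ∸ suc j)            ≡⟨ sym (seqU-restart cj≡0 (m ∸ suc j)) ⟩
      seqU p i c (m ∸ suc j + suc j)    ≡⟨ cong (seqU p i c) (m∸n+n≡m j<m) ⟩
      seqU p i c m                      ≡⟨ cm≡g ⟩
      g                                 ∎)

  zero-orbit⇒IsTerm : ∀ {g} → g ≢ 0 → ∀ d → seqU p i 0 d ≡ g → IsTerm p i c g
  zero-orbit⇒IsTerm g≢0 zero    0≡g = contradiction (sym 0≡g) g≢0
  zero-orbit⇒IsTerm g≢0 (suc k) eq  = occurs⇒IsTerm g≢0 k (trans (sym (seqU-zero-suc k)) eq)

module _ (p : ℕ) .{{_ : NonZero p}} (i : ℕ)
  (step-injective : ∀ {x y} → x < p → y < p → step p i x ≡ step p i y → x ≡ y) where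

  seqU-injective : ∀ {x y} → x < p → y < p → ∀ n → seqU p i x n ≡ seqU p i y n → x ≡ y
  seqU-injective x<p y<p zero    eq = eq
  seqU-injective x<p y<p (suc n) eq =
    seqU-injective x<p y<p n (step-injective (seqU-< p i x<p n) (seqU-< p i y<p n) eq)

  seqU-cycle : ∀ {x} → x < p → ∃ λ t → seqU p i x (suc t) ≡ x
  seqU-cycle {x} x<p with pigeonhole (n<1+n p) (λ k → fromℕ< (seqU-< p i x<p (toℕ k)))
  ... | a , b , a<b , eq with m≤n⇒∃[o]m+o≡n a<b
  ... | t , 1+a+t≡b = t , seqU-injective (seqU-< p i x<p (suc t)) x<p (toℕ a) (begin
    seqU p i (seqU p i x (suc t)) (toℕ a)   ≡⟨ sym (seqU-+ p i x (toℕ a) (suc t)) ⟩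
    seqU p i x (toℕ a + suc t)              ≡⟨ cong (seqU p i x) (trans (+-suc (toℕ a) t) 1+a+t≡b) ⟩
    seqU p i x (toℕ b)                      ≡⟨ sym (toℕ-fromℕ< (seqU-< p i x<p (toℕ b))) ⟩
    toℕ (fromℕ< (seqU-< p i x<p (toℕ b)))  ≡⟨ cong toℕ (sym eq) ⟩
    toℕ (fromℕ< (seqU-< p i x<p (toℕ a)))  ≡⟨ toℕ-fromℕ< (seqU-< p i x<p (toℕ a)) ⟩
    seqU p i x (toℕ a)                      ∎)

  -- d is n full turns around the cycle through x, minus the n steps already taken.
  seqU-returns : ∀ {x} → x < p → ∀ n → ∃ λ d → seqU p i (seqU p i x n) d ≡ x
  seqU-returns {x} x<p n with seqU-cycle x<p
  ... | t , cycle = n * suc t ∸ n , (begin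
    seqU p i (seqU p i x n) (n * suc t ∸ n)   ≡⟨ sym (seqU-+ p i x (n * suc t ∸ n) n) ⟩
    seqU p i x (n * suc t ∸ n + n)            ≡⟨ cong (seqU p i x) (m∸n+n≡m (m≤m*n n (suc t))) ⟩
    seqU p i x (n * suc t)                    ≡⟨ seqU-*-period p i cycle n ⟩
    x                                         ∎)

mainTheorem7 : (p : ℕ) → .{{_ : NonZero p}} → Prime p → p ≢ 2 → RoguePrime p →
    (i : ℕ) → (i ≡ 1) ⊎ (i ≡ 2) → (g : ℕ) → InA p i g →
    RogueLoop p i g ⇔ (¬ IsTerm p i (negOnePow p (suc i)) g)
mainTheorem7 p pr p≢2 _ i _ g (1≤g , g<p , _) = mk⇔ loop⇒¬term ¬term⇒loop
  where
  step-injective : ∀ {x y} → x < p → y < p → step p i x ≡ step p i y → x ≡ y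
  step-injective = prime≢2⇒step-injective pr p≢2 i

  g≢0 : g ≢ 0
  g≢0 refl = contradiction 1≤g λ ()

  loop⇒¬term : RogueLoop p i g → ¬ IsTerm p i (negOnePow p (suc i)) g
  loop⇒¬term (never0 , _) (n , cn≡g , _)
    with seqU-returns p i step-injective (≤-<-trans z≤n g<p) (suc n)
  ... | d , eq = never0 d (subst (λ x → seqU p i x d ≡ 0) (trans (seqU-zero-suc p i n) cn≡g) eq)

  ¬term⇒loop : ¬ IsTerm p i (negOnePow p (suc i)) g → RogueLoop p i g
  ¬term⇒loop ¬term with seqU-cycle p i step-injective g<p
  ... | t , cycle = never0 , suc t , s≤s z≤n , seqU-+-period p i cycle
    where
    never0 : ∀ n → seqU p i g n ≢ 0
    never0 n gn≡0 with seqU-returns p i step-injective g<p n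
    ... | d , eq = ¬term (zero-orbit⇒IsTerm p i g≢0 d (subst (λ x → seqU p i x d ≡ g) gn≡0 eq))
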